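{- For integers $C\geq 2$ and $L\geq 3$, $\gamma_{P,C-1}(WKP_{(C,L)})\leq\left\lceil\frac{L+1}{3}\right\rceil$.
   Context: For a graph $G$, $S\subseteq V(G)$ and an integer $k\ge 0$, define $\mathcal{P}^0_{G,k}(S)=N_G[S]$ (closed neighbourhood of $S$) and $\mathcal{P}^{i+1}_{G,k}(S)=\bigcup\{N_G[v] : v\in \mathcal{P}^i_{G,k}(S),\ |N_G[v]\setminus \mathcal{P}^i_{G,k}(S)|\le k\}$. These sets increase and stabilize at a set $\mathcal{P}^\infty_{G,k}(S)$. A $k$-power dominating set ($k$-PDS) is a set $S$ with $\mathcal{P}^\infty_{G,k}(S)=V(G)$, and $\gamma_{P,k}(G)$ is the minimum cardinality of a $k$-PDS of $G$. Let $[C]_0=\{0,\dots,C-1\}$. The WK-Pyramid network $WKP_{(C,L)}$ has vertex set $\{(r,(a_r a_{r-1}\cdots a_1)) : r\in\{1,\dots,L\},\ a_i\in[C]_0\}\cup\{(0,(1))\}$; a vertex $(r,(a_r\cdots a_1))$ is said to be at level $r$. The vertex $(0,(1))$ is adjacent to every vertex at level $1$. A vertex $(r,(a_r\cdots a_1))$ with $r>0$ is adjacent to: (1) the vertices $(r,(a_r\cdots a_2 b))$ with $b\in[C]_0$, $b\ne a_1$; (2) the vertex $(r,(a_r\cdots a_{j+1}a_{j-1}(a_j)^{j-1}))$ if there is a $j$ with $2\le j\le r$, $a_{j-1}=a_{j-2}=\cdots=a_1$ and $a_j\ne a_{j-1}$, where $(a_j)^{j-1}$ denotes $a_j$ repeated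 $j-1$ times; (3) the vertices $(r+1,(a_r\cdots a_1 b))$ for $b\in[C]_0$ (when $r<L$); (4) the vertex $(r-1,(a_r\cdots a_2))$ (for $r=1$ this is $(0,(1))$). -}

module Defs where

open import Data.Nat using (ℕ; zero; suc; _+_; _≤_; _∸_)
open import Data.Nat.DivMod using (_/_)
open import Data.Fin using (Fin)
open import Data.Vec using (Vec; []; _∷_; replicate; _++_)
open import Data.List using (List; length)
open import Data.List.Membership.Propositional using (_∈_)
open import Data.Product using (Σ; ∃; _×_; _,_; proj₁)
open import Data.Sum using (_⊎_)
open import Relation.Binary.PropositionalEquality using (_≡_; _≢_)
open import Relation.Nullary using (¬_)

-- A vertex (r,(a_r ... a_1)) is encoded as the pair (r , w) with
-- w : Vec (Fin C) r and  w = a_1 ∷ a_2 ∷ ... ∷ a_r ∷ []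
-- (i.e. the LAST digit a_1 is the head of the vector).
-- The apex (0,(1)) is encoded as (0 , []).

Vertex : ℕ → Set
Vertex C = Σ ℕ (Vec (Fin C))

level : ∀ {C} → Vertex C → ℕ
level = proj₁

IsVertex : ∀ {C} → ℕ → Vertex C → Set
IsVertex L v = level v ≤ L

-- The adjacency rules (1)-(3) as directed "arcs"; rule (4) is the
-- reverse of rule (3), and adjacency is the symmetric closure.
data Arc (C L : ℕ) : Vertex C → Vertex C → Set where
  sib   : ∀ {n} (w : Vec (Fin C) n) (a b : Fin C) → a ≢ b →
          Arc C L (suc n , a ∷ w) (suc n , b ∷ w)
  -- rule (2): with j = suc (suc i) (so 2 ≤ j ≤ r),
  --   a_1 = ... = a_{j-1} = x ,  a_j = y ≠ x ,  a_r..a_{j+1} = rest ;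
  --   neighbour: a_r..a_{j+1} x y^{j-1}
  swp   : ∀ {m} (i : ℕ) (x y : Fin C) (rest : Vec (Fin C) m) → x ≢ y →
          Arc C L (suc i + suc m , replicate (suc i) x ++ (y ∷ rest))
                  (suc i + suc m , replicate (suc i) y ++ (x ∷ rest))
  -- rule (3): child (r+1,(a_r..a_1 b)) when r < L
  -- (for r = 0 this is the apex adjacent to every level-1 vertex)
  child : ∀ {r} (w : Vec (Fin C) r) (b : Fin C) → suc r ≤ L →
          Arc C L (r , w) (suc r , b ∷ w)

Adj : (C L : ℕ) → Vertex C → Vertex C → Set
Adj C L u v = Arc C L u v ⊎ Arc C L v u

ClosedNbr : (C L : ℕ) → Vertex C → Vertex C → Set
ClosedNbr C L u v = (u ≡ v) ⊎ Adj C L u v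

ClosedNbrSet : (C L : ℕ) → List (Vertex C) → Vertex C → Set
ClosedNbrSet C L S v = ∃ λ s → s ∈ S × ClosedNbr C L s v

-- |N[u] \ P| ≤ k  : the vertices of N[u] outside P can be listed by at
-- most k entries
AtMostOutside : (C L k : ℕ) → (Vertex C → Set) → Vertex C → Set
AtMostOutside C L k P u =
  ∃ λ (ws : List (Vertex C)) → length ws ≤ k ×
    (∀ w → ClosedNbr C L u w → ¬ P w → w ∈ ws)

PowerStep : (C L k : ℕ) → List (Vertex C) → ℕ → Vertex C → Set
PowerStep C L k S zero    v = ClosedNbrSet C L S v
PowerStep C L k S (suc i) v =
  ∃ λ u → PowerStep C L k S i u ×
          AtMostOutside C L k (PowerStep C L k S i) u ×
          ClosedNbr C L u v

PowerClosure : (C L k : ℕ) → List (Vertex C) → Vertex C → Set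
PowerClosure C L k S v = ∃ λ i → PowerStep C L k S i v

IsKPDS : (C L k : ℕ) → List (Vertex C) → Set
IsKPDS C L k S =
  (∀ s → s ∈ S → IsVertex L s) ×
  (∀ v → IsVertex L v → PowerClosure C L k S v)

PowerDomNumberLE : (C L k m : ℕ) → Set
PowerDomNumberLE C L k m =
  ∃ λ (S : List (Vertex C)) → length S ≤ m × IsKPDS C L k S

ceil3 : ℕ → ℕ
ceil3 n = (n + 2) / 3

-- Words are written with the last digit first, as in Defs. Take S to be the vertices 0^c of the
-- all-zero path at every third level, so that N[S] contains the whole path; a constant word has
-- no swap neighbour, so every path vertex is settled (observed together with its swap neighbours).
-- Then, by induction on the height of a subtree: if w and its z-spine z w, z z w, ... are settled,
-- the subtree of z w gets observed first; z w now misses only its C - 1 siblings b w and forces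
-- them; and the spine z^(t+1) b w of each sibling is forced by its unique swap neighbour
-- b^(t+1) z w, which lies in the subtree of z w. So the subtree of each b w is in the same
-- situation one level higher, and the whole network is observed.
module Submission where

open import Defs
open import Data.Nat using (ℕ; _≤_; _+_; _∸_; zero; suc; z≤n; s≤s; _≤′_; ≤′-refl; ≤′-step)
open import Data.Nat.Properties
  using (≤-refl; ≤-trans; ≤-reflexive; <-irrefl; n≤1+n; m≤m+n; m≤n+m; +-suc; +-identityʳ; ≤⇒≤′)
open import Data.Nat.DivMod using (m/n≡1+[m∸n]/n)
open import Data.Fin using (Fin; punchIn; punchOut; _≟_) renaming (zero to fzero)
open import Data.Fin.Properties using (punchIn-punchOut)
open import Data.Vec using (Vec; []; _∷_; replicate; _++_; toList)
open import Data.Vec.Properties using (toList-++; toList-replicate)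
import Data.Vec.Relation.Unary.All as All
open import Data.Vec.Relation.Unary.All.Properties using (++⁻)
import Data.List as List
open import Data.List using (List; length)
open import Data.List.Properties using (∷-injective; length-map; length-tabulate)
open import Data.List.Membership.Propositional using (_∈_)
open import Data.List.Membership.Propositional.Properties using (∈-map⁺; ∈-map⁻; ∈-tabulate⁺)
open import Data.List.Relation.Unary.Any using (here; there)
open import Data.Product using (Σ; ∃; _×_; _,_; proj₁; proj₂)
open import Data.Sum using (_⊎_; inj₁; inj₂)
open import Data.Empty using (⊥-elim)
open import Data.Unit using (⊤; tt)
open import Function using (_∘_)
open import Relation.Binary.PropositionalEquality
open import Relation.Nullary using (¬_; yes; no)

toList-injectiveΣ : ∀ {A : Set} {m n} (xs : Vec A m) (ys : Vec A n) →
                    toList xs ≡ toList ys → _≡_ {A = Σ ℕ (Vec A)} (m , xs) (n , ys)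
toList-injectiveΣ []       []       _  = refl
toList-injectiveΣ (x ∷ xs) (y ∷ ys) eq with ∷-injective eq
... | refl , eq′ with toList-injectiveΣ xs ys eq′
...   | refl = refl

toList-replicate-++ : ∀ {A : Set} {m} n (a : A) (xs : Vec A m) →
                      toList (replicate n a ++ xs) ≡ List.replicate n a List.++ toList xs
toList-replicate-++ n a xs =
  trans (toList-++ (replicate n a) xs) (cong (List._++ toList xs) (toList-replicate n a))

replicate-++-injective : ∀ {A : Set} i j {a b c d : A} {r s} → a ≢ b → c ≢ d →
  List.replicate (suc i) a List.++ (b List.∷ r) ≡ List.replicate (suc j) c List.++ (d List.∷ s) →
  i ≡ j × a ≡ c × b ≡ d × r ≡ s
replicate-++-injective zero zero _ _ eq with ∷-injective eq
... | a≡c , eq′ with ∷-injective eq′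
...   | b≡d , r≡s = refl , a≡c , b≡d , r≡s
replicate-++-injective zero (suc j) a≢b _ eq with ∷-injective eq
... | a≡c , eq′ = ⊥-elim (a≢b (trans a≡c (sym (proj₁ (∷-injective eq′)))))
replicate-++-injective (suc i) zero _ c≢d eq with ∷-injective eq
... | a≡c , eq′ = ⊥-elim (c≢d (trans (sym a≡c) (proj₁ (∷-injective eq′))))
replicate-++-injective (suc i) (suc j) a≢b c≢d eq
  with replicate-++-injective i j a≢b c≢d (proj₂ (∷-injective eq))
... | refl , a≡c , b≡d , r≡s = refl , a≡c , b≡d , r≡s

All-replicate : ∀ {A : Set} n (a : A) → All.All (a ≡_) (replicate n a)
All-replicate zero    a = All.[]
All-replicate (suc n) a = refl All.∷ All-replicate n a

module _ {C : ℕ} where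

  data SwapArc : Vertex C → Vertex C → Set where
    swap : ∀ {m} i {a b : Fin C} (rest : Vec (Fin C) m) → a ≢ b →
           SwapArc (suc i + suc m , replicate (suc i) a ++ (b ∷ rest))
                   (suc i + suc m , replicate (suc i) b ++ (a ∷ rest))

  SwapArc-sym : ∀ {u v} → SwapArc u v → SwapArc v u
  SwapArc-sym (swap i rest a≢b) = swap i rest (≢-sym a≢b)

  SwapArc-functional : ∀ {u v v′} → SwapArc u v → SwapArc u v′ → v ≡ v′
  SwapArc-functional s s′ = go s s′ refl
    where
    word : Vertex C → List (Fin C)
    word (_ , xs) = toList xs

    go : ∀ {u u′ v v′} → SwapArc u v → SwapArc u′ v′ → u ≡ u′ → v ≡ v′
    go (swap i {a} {b} r a≢b) (swap j {c} {d} s c≢d) u≡u′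
      with replicate-++-injective i j a≢b c≢d
             (trans (sym (toList-replicate-++ (suc i) a (b ∷ r)))
               (trans (cong word u≡u′) (toList-replicate-++ (suc j) c (d ∷ s))))
    ... | refl , refl , refl , r≡s = toList-injectiveΣ _ _ (begin
      toList (replicate (suc i) b ++ (a ∷ r))              ≡⟨ toList-replicate-++ (suc i) b (a ∷ r) ⟩
      List.replicate (suc i) b List.++ (a List.∷ toList r) ≡⟨ cong (λ q → List.replicate (suc i) b List.++ (a List.∷ q)) r≡s ⟩
      List.replicate (suc i) b List.++ (a List.∷ toList s) ≡⟨ toList-replicate-++ (suc i) b (a ∷ s) ⟨
      toList (replicate (suc i) b ++ (a ∷ s))              ∎)
      where open ≡-Reasoning

  replicate-¬SwapArc : ∀ l (c : Fin C) {v} → ¬ SwapArc (l , replicate l c) v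
  replicate-¬SwapArc l c s = go s (All-replicate l c)
    where
    go : ∀ {u v} → SwapArc u v → ¬ All.All (c ≡_) (proj₂ u)
    go (swap i {a} rest a≢b) constant with ++⁻ (replicate (suc i) a) constant
    ... | c≡a All.∷ _ , c≡b All.∷ _ = a≢b (trans (sym c≡a) c≡b)

  data Descendant (v : Vertex C) : Vertex C → Set where
    self  : Descendant v v
    below : ∀ {l u} b → Descendant v (l , u) → Descendant v (suc l , b ∷ u)

  descendant-++ : ∀ {r d} (w : Vec (Fin C) r) (s : Vec (Fin C) d) → Descendant (r , w) (d + r , s ++ w)
  descendant-++ w []      = self
  descendant-++ w (b ∷ s) = below b (descendant-++ w s)

  descendant-trans : ∀ {u v x} → Descendant u v → Descendant v x → Descendant u x
  descendant-trans d self         = d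
  descendant-trans d (below b d′) = below b (descendant-trans d d′)

  descendant-level : ∀ {v x} → Descendant v x → level v ≤ level x
  descendant-level self        = ≤-refl
  descendant-level (below b d) = ≤-trans (descendant-level d) (n≤1+n _)

  root-descendant : ∀ x → Descendant (0 , []) x
  root-descendant (zero  , [])    = self
  root-descendant (suc l , b ∷ u) = below b (root-descendant (l , u))

  descendant-split : ∀ {r w x} → Descendant (r , w) x →
                     x ≡ (r , w) ⊎ ∃ λ b → Descendant (suc r , b ∷ w) x
  descendant-split self = inj₁ refl
  descendant-split (below b d) with descendant-split d
  ... | inj₁ refl        = inj₂ (b , self)
  ... | inj₂ (c , d′)    = inj₂ (c , below b d′)

  closedNbr-elim : ∀ {L r} {a : Fin C} {w : Vec (Fin C) r} (Q : Vertex C → Set) →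
    Q (suc r , a ∷ w) →
    (∀ b → b ≢ a → Q (suc r , b ∷ w)) →
    (∀ x → SwapArc (suc r , a ∷ w) x → Q x) →
    (∀ b → suc (suc r) ≤ L → Q (suc (suc r) , b ∷ a ∷ w)) →
    Q (r , w) →
    ∀ x → ClosedNbr C L (suc r , a ∷ w) x → Q x
  closedNbr-elim Q qself qsib qswap qchild qparent x nbr with nbr
  ... | inj₁ refl                            = qself
  ... | inj₂ (inj₁ (sib _ _ b a≢b))          = qsib b (≢-sym a≢b)
  ... | inj₂ (inj₁ (swp i _ y rest a≢y))     = qswap _ (swap i rest a≢y)
  ... | inj₂ (inj₁ (child _ b le))           = qchild b le
  ... | inj₂ (inj₂ (sib _ b _ b≢a))          = qsib b b≢a
  ... | inj₂ (inj₂ (swp i y _ rest y≢a))     = qswap _ (SwapArc-sym (swap i rest y≢a))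
  ... | inj₂ (inj₂ (child _ _ _))            = qparent

module PowerDomination (C L k : ℕ) (S : List (Vertex C)) where

  Known : ℕ → Vertex C → Set
  Known = PowerStep C L k S

  known-suc : ∀ {i x} → Known i x → Known (suc i) x
  known-suc {zero} (s , s∈S , nbr) =
    s , (s , s∈S , inj₁ refl) , (List.[] , z≤n , λ y nbr′ unknown → ⊥-elim (unknown (s , s∈S , nbr′))) , nbr
  known-suc {suc i} (u , known , (ws , |ws|≤k , outside) , nbr) =
    u , known-suc known , (ws , |ws|≤k , λ y nbr′ unknown → outside y nbr′ (unknown ∘ known-suc)) , nbr

  known-mono : ∀ {i j x} → i ≤ j → Known i x → Known j x
  known-mono = go ∘ ≤⇒≤′
    where
    go : ∀ {i j x} → i ≤′ j → Known i x → Known j x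
    go ≤′-refl        = λ known → known
    go (≤′-step i≤′j) = known-suc ∘ go i≤′j

  force : ∀ {i u} → Known i u → (ws : List (Vertex C)) → length ws ≤ k →
          (∀ x → ClosedNbr C L u x → x ∈ ws ⊎ Known i x) →
          ∀ x → ClosedNbr C L u x → Known (suc i) x
  force {i} {u} known ws |ws|≤k cover x nbr = u , known , (ws , |ws|≤k , outside) , nbr
    where
    outside : ∀ y → ClosedNbr C L u y → ¬ Known i y → y ∈ ws
    outside y nbr′ unknown with cover y nbr′
    ... | inj₁ y∈ws  = y∈ws
    ... | inj₂ known′ = ⊥-elim (unknown known′)

  SubtreeKnown : ℕ → Vertex C → Set
  SubtreeKnown i v = ∀ x → level x ≤ L → Descendant v x → Known i x

  subtreeKnown-mono : ∀ {i j v} → i ≤ j → SubtreeKnown i v → SubtreeKnown j v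
  subtreeKnown-mono i≤j full x x≤L d = known-mono i≤j (full x x≤L d)

  subtreeKnown-intro : ∀ {i r} {w : Vec (Fin C) r} → Known i (r , w) →
               (∀ b → suc r ≤ L → SubtreeKnown i (suc r , b ∷ w)) → SubtreeKnown i (r , w)
  subtreeKnown-intro known children x x≤L d with descendant-split d
  ... | inj₁ refl     = known
  ... | inj₂ (b , d′) = children b (≤-trans (descendant-level d′) x≤L) x x≤L d′

  Settled : ℕ → Vertex C → Set
  Settled i x = Known i x × (∀ y → SwapArc x y → Known i y)

-- A bound on when a subtree of height m is observed, its spine being settled at time i.
settleTime : ℕ → ℕ → ℕ
settleTime zero    i = i
settleTime (suc m) i = settleTime m (suc (settleTime m i))

≤-settleTime : ∀ m i → i ≤ settleTime m i
≤-settleTime zero    i = ≤-refl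
≤-settleTime (suc m) i =
  ≤-trans (≤-settleTime m i) (≤-trans (n≤1+n _) (≤-settleTime m (suc (settleTime m i))))

module Propagation (n L : ℕ) (S : List (Vertex (suc (suc n)))) where
  open PowerDomination (suc (suc n)) L (suc n) S

  Digit : Set
  Digit = Fin (suc (suc n))

  module Spine (z : Digit) where

    SpineSettled : ℕ → ℕ → (r : ℕ) → Vec Digit r → Set
    SpineSettled i zero    r w = ⊤
    SpineSettled i (suc m) r w = Settled i (suc r , z ∷ w) × SpineSettled i m (suc r) (z ∷ w)

    sibling : ∀ {r} → Vec Digit r → Fin (suc n) → Vertex (suc (suc n))
    sibling {r} w t = suc r , punchIn z t ∷ w

    siblings : ∀ {r} → Vec Digit r → List (Vertex (suc (suc n)))
    siblings w = List.tabulate (sibling w)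

    siblings-complete : ∀ {r} (w : Vec Digit r) b → b ≢ z → (suc r , b ∷ w) ∈ siblings w
    siblings-complete {r} w b b≢z =
      subst (λ c → (suc r , c ∷ w) ∈ siblings w) (punchIn-punchOut (≢-sym b≢z)) (∈-tabulate⁺ {f = sibling w} (punchOut (≢-sym b≢z)))

    sibling-forced : ∀ {j r} {w : Vec Digit r} → suc r ≤ L →
      Known j (r , w) → (∀ y → SwapArc (suc r , z ∷ w) y → Known j y) → SubtreeKnown j (suc r , z ∷ w) →
      ∀ b → b ≢ z → Known (suc j) (suc r , b ∷ w)
    sibling-forced {j} {r} {w} r<L parent swaps full b b≢z =
      force (full _ r<L self) (siblings w) (≤-reflexive (length-tabulate (sibling w))) cover
            _ (inj₂ (inj₁ (sib w z b (≢-sym b≢z))))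
      where
      cover : ∀ x → ClosedNbr (suc (suc n)) L (suc r , z ∷ w) x → x ∈ siblings w ⊎ Known j x
      cover = closedNbr-elim _ (inj₂ (full _ r<L self)) (λ c c≢z → inj₁ (siblings-complete w c c≢z))
                (λ x s → inj₂ (swaps x s)) (λ c le → inj₂ (full _ le (below c self))) (inj₂ parent)

    swapPartner-settled : ∀ {j r} {w : Vec Digit r} {y} → SubtreeKnown j (suc r , z ∷ w) → y ≢ z →
      ∀ t → suc t + suc r ≤ L → Settled (suc j) (suc t + suc r , replicate (suc t) z ++ (y ∷ w))
    swapPartner-settled {j} {r} {w} {y} full y≢z t level≤L =
        force (inZ self level≤L) List.[ σ ] (s≤s z≤n) cover σ (inj₂ (inj₁ (swp t y z w y≢z)))
      , λ x s → subst (Known (suc j)) (SwapArc-functional (swap t w (≢-sym y≢z)) s) (known-suc (inZ self level≤L))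
      where
      σ τ : Vertex (suc (suc n))
      σ = suc t + suc r , replicate (suc t) z ++ (y ∷ w)
      τ = suc t + suc r , replicate (suc t) y ++ (z ∷ w)

      inZ : ∀ {x} → Descendant τ x → level x ≤ L → Known j x
      inZ d x≤L = full _ x≤L (descendant-trans (descendant-++ (z ∷ w) (replicate (suc t) y)) d)

      cover : ∀ x → ClosedNbr (suc (suc n)) L τ x → x ∈ List.[ σ ] ⊎ Known j x
      cover = closedNbr-elim _ (inj₂ (inZ self level≤L))
        (λ b _ → inj₂ (full _ level≤L (descendant-++ (z ∷ w) (b ∷ replicate t y))))
        (λ x s → inj₁ (here (SwapArc-functional s (swap t w y≢z))))
        (λ b le → inj₂ (inZ (below b self) le))
        (inj₂ (full _ (≤-trans (n≤1+n _) level≤L) (descendant-++ (z ∷ w) (replicate t y))))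

    sibling-spine : ∀ {j r} {w : Vec Digit r} {y} → SubtreeKnown j (suc r , z ∷ w) → y ≢ z →
      ∀ m t → t + suc r + m ≡ L → SpineSettled (suc j) m (t + suc r) (replicate t z ++ (y ∷ w))
    sibling-spine full y≢z zero    t _  = tt
    sibling-spine {r = r} full y≢z (suc m) t eq =
      swapPartner-settled full y≢z t (subst (suc t + suc r ≤_) eq′ (m≤m+n _ m)) ,
      sibling-spine full y≢z m (suc t) eq′
      where
      eq′ : suc t + suc r + m ≡ L
      eq′ = trans (sym (+-suc (t + suc r) m)) eq

    subtreeKnown-of-spine : ∀ m {r} (w : Vec Digit r) {i} → r + m ≡ L → Known i (r , w) →
                   SpineSettled i m r w → SubtreeKnown (settleTime m i) (r , w)
    subtreeKnown-of-spine zero {r} w r+0≡L known _ =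
      subtreeKnown-intro known (λ _ r<L → ⊥-elim (<-irrefl (trans (sym (+-identityʳ r)) r+0≡L) r<L))
    subtreeKnown-of-spine (suc m) {r} w {i} r+m≡L known ((zKnown , zSwaps) , spine) =
      subtreeKnown-intro (known-mono (≤-settleTime (suc m) i) known) childFull
      where
      j : ℕ
      j = settleTime m i

      i≤j : i ≤ j
      i≤j = ≤-settleTime m i

      eq : suc r + m ≡ L
      eq = trans (sym (+-suc r m)) r+m≡L

      zSubtree : SubtreeKnown j (suc r , z ∷ w)
      zSubtree = subtreeKnown-of-spine m (z ∷ w) eq zKnown spine

      childFull : ∀ b → suc r ≤ L → SubtreeKnown (settleTime m (suc j)) (suc r , b ∷ w)
      childFull b r<L with b ≟ z
      ... | yes refl = subtreeKnown-mono (≤-trans (n≤1+n j) (≤-settleTime m (suc j))) zSubtree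
      ... | no b≢z   = subtreeKnown-of-spine m (b ∷ w) eq
        (sibling-forced r<L (known-mono i≤j known) (λ y s → known-mono i≤j (zSwaps y s)) zSubtree b b≢z)
        (sibling-spine zSubtree b≢z m 0 eq)

  zero-spine-settled : (∀ l → l ≤ L → Known 0 (l , replicate l fzero)) →
    ∀ m r → r + m ≡ L → Spine.SpineSettled fzero 0 m r (replicate r fzero)
  zero-spine-settled known zero    r _  = tt
  zero-spine-settled known (suc m) r eq =
    (known (suc r) (subst (suc r ≤_) eq′ (m≤m+n _ m)) , λ _ s → ⊥-elim (replicate-¬SwapArc (suc r) fzero s)) ,
    zero-spine-settled known m (suc r) eq′
    where
    eq′ : suc r + m ≡ L
    eq′ = trans (sym (+-suc r m)) eq

  zero-spine-dominates : (∀ l → l ≤ L → Known 0 (l , replicate l fzero)) →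
    ∀ v → IsVertex L v → PowerClosure (suc (suc n)) L (suc n) S v
  zero-spine-dominates known v v≤L =
    settleTime L 0 ,
    Spine.subtreeKnown-of-spine fzero L [] refl (known 0 z≤n) (zero-spine-settled known L 0 refl) v v≤L (root-descendant v)

dominatingLevels : ℕ → List ℕ
dominatingLevels zero                = List.[ 0 ]
dominatingLevels (suc zero)          = List.[ 1 ]
dominatingLevels (suc (suc zero))    = List.[ 1 ]
dominatingLevels (suc (suc (suc N))) = suc (suc N) List.∷ dominatingLevels N

Near : ℕ → ℕ → Set
Near l c = l ≡ c ⊎ suc l ≡ c ⊎ l ≡ suc c

dominatingLevels-≤ : ∀ N {c} → c ∈ dominatingLevels N → c ≤ N
dominatingLevels-≤ zero                (here refl) = z≤n
dominatingLevels-≤ (suc zero)          (here refl) = ≤-refl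
dominatingLevels-≤ (suc (suc zero))    (here refl) = s≤s z≤n
dominatingLevels-≤ (suc (suc (suc N))) (here refl) = s≤s (s≤s (n≤1+n N))
dominatingLevels-≤ (suc (suc (suc N))) (there c∈) = ≤-trans (dominatingLevels-≤ N c∈) (m≤n+m N 3)

≤3+-cases : ∀ N {l} → l ≤ 3 + N → l ≤ N ⊎ l ≡ 1 + N ⊎ l ≡ 2 + N ⊎ l ≡ 3 + N
≤3+-cases zero    {zero}                   _ = inj₁ z≤n
≤3+-cases zero    {suc zero}               _ = inj₂ (inj₁ refl)
≤3+-cases zero    {suc (suc zero)}         _ = inj₂ (inj₂ (inj₁ refl))
≤3+-cases zero    {suc (suc (suc zero))}   _ = inj₂ (inj₂ (inj₂ refl))
≤3+-cases zero    {suc (suc (suc (suc _)))} (s≤s (s≤s (s≤s ())))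
≤3+-cases (suc N) {zero}                   _ = inj₁ z≤n
≤3+-cases (suc N) {suc l} (s≤s l≤) with ≤3+-cases N l≤
... | inj₁ l≤N                   = inj₁ (s≤s l≤N)
... | inj₂ (inj₁ refl)           = inj₂ (inj₁ refl)
... | inj₂ (inj₂ (inj₁ refl))    = inj₂ (inj₂ (inj₁ refl))
... | inj₂ (inj₂ (inj₂ refl))    = inj₂ (inj₂ (inj₂ refl))

dominatingLevels-near : ∀ N {l} → l ≤ N → ∃ λ c → c ∈ dominatingLevels N × Near l c
dominatingLevels-near zero                {zero}             _ = 0 , here refl , inj₁ refl
dominatingLevels-near (suc zero)          {zero}             _ = 1 , here refl , inj₂ (inj₁ refl)
dominatingLevels-near (suc zero)          {suc zero}         _ = 1 , here refl , inj₁ refl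
dominatingLevels-near (suc (suc zero))    {zero}             _ = 1 , here refl , inj₂ (inj₁ refl)
dominatingLevels-near (suc (suc zero))    {suc zero}         _ = 1 , here refl , inj₁ refl
dominatingLevels-near (suc (suc zero))    {suc (suc zero)}   _ = 1 , here refl , inj₂ (inj₂ refl)
dominatingLevels-near (suc zero)          {suc (suc _)}       (s≤s ())
dominatingLevels-near (suc (suc zero))    {suc (suc (suc _))} (s≤s (s≤s ()))
dominatingLevels-near (suc (suc (suc N))) l≤ with ≤3+-cases N l≤
... | inj₁ l≤N with dominatingLevels-near N l≤N
...   | c , c∈ , near = c , there c∈ , near
dominatingLevels-near (suc (suc (suc N))) l≤ | inj₂ (inj₁ refl)        = _ , here refl , inj₂ (inj₁ refl)
dominatingLevels-near (suc (suc (suc N))) l≤ | inj₂ (inj₂ (inj₁ refl)) = _ , here refl , inj₁ refl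
dominatingLevels-near (suc (suc (suc N))) l≤ | inj₂ (inj₂ (inj₂ refl)) = _ , here refl , inj₂ (inj₂ refl)

length-dominatingLevels : ∀ N → length (dominatingLevels N) ≤ ceil3 (N + 1)
length-dominatingLevels zero                = ≤-refl
length-dominatingLevels (suc zero)          = ≤-refl
length-dominatingLevels (suc (suc zero))    = ≤-refl
length-dominatingLevels (suc (suc (suc N))) =
  subst (suc (length (dominatingLevels N)) ≤_) (sym (m/n≡1+[m∸n]/n {3 + N + 1 + 2} {3} (s≤s (s≤s (s≤s z≤n)))))
        (s≤s (length-dominatingLevels N))

spineVertex : ∀ {C} → ℕ → Vertex (suc C)
spineVertex l = l , replicate l fzero

near-closedNbr : ∀ {C L l c} → Near l c → c ≤ L → l ≤ L →
                 ClosedNbr (suc C) L (spineVertex c) (spineVertex l)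
near-closedNbr (inj₁ refl)        _   _   = inj₁ refl
near-closedNbr (inj₂ (inj₁ refl)) c≤L _   = inj₂ (inj₂ (child _ fzero c≤L))
near-closedNbr (inj₂ (inj₂ refl)) _   l≤L = inj₂ (inj₁ (child _ fzero l≤L))

mainTheorem8 : (C L : ℕ) → 2 ≤ C → 3 ≤ L →
    PowerDomNumberLE C L (C ∸ 1) (ceil3 (L + 1))
mainTheorem8 (suc zero)      L (s≤s ()) _
mainTheorem8 (suc (suc n)) L _ _ = S , |S|≤ , S⊆V , zero-spine-dominates spineKnown
  where
  S : List (Vertex (suc (suc n)))
  S = List.map spineVertex (dominatingLevels L)

  open Propagation n L S using (zero-spine-dominates)
  open PowerDomination (suc (suc n)) L (suc n) S using (Known)

  |S|≤ : length S ≤ ceil3 (L + 1)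
  |S|≤ = subst (_≤ ceil3 (L + 1)) (sym (length-map spineVertex (dominatingLevels L))) (length-dominatingLevels L)

  S⊆V : ∀ s → s ∈ S → IsVertex L s
  S⊆V s s∈S with ∈-map⁻ spineVertex s∈S
  ... | c , c∈ , refl = dominatingLevels-≤ L c∈

  spineKnown : ∀ l → l ≤ L → Known 0 (spineVertex l)
  spineKnown l l≤L with dominatingLevels-near L l≤L
  ... | c , c∈ , near =
    spineVertex c , ∈-map⁺ spineVertex c∈ , near-closedNbr near (dominatingLevels-≤ L c∈) l≤L
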